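{- Let $\tau=(3,1,2)$ and let $\rho=(\rho_1,\dots,\rho_n)\in\mathcal S_n$ be arbitrary. Consider a jump of depth $d\ge1$ at position $i$ in $\psi_\tau(\rho)$, which is followed immediately by $l$ consecutive down-steps (corresponding to $\rho_{i+1},\dots,\rho_{i+l}$), and which is preceded immediately by $m$ consecutive down-steps (corresponding to $\rho_{i-m+1},\dots,\rho_i$) including the one corresponding to the preceding left-to-right maximum, i.e. $\rho_{i-m+1}$ is the left-to-right maximum preceding the jump and the path segment is: an up-step, then $m$ down-steps, then $d$ down-jumps, then $l$ down-steps. Then the jump implies $m\cdot d\cdot l$ occurrences of $\tau$ in $\rho$ of the form $(\rho_{i-g+1},\rho_{i+j},\rho_k)$, where $g\in\{1,\dots,m\}$, $j\in\{1,\dots,l\}$, and $\rho_k$ is one of the $d$ entries of $\rho$ with $k>i$ which are bigger than $\rho_{i+1}$ and smaller than $\rho_i$.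
   Context: For a permutation $\rho=(\rho_1,\dots,\rho_n)$ of $\{1,\dots,n\}$, an occurrence of the pattern $(3,1,2)$ is a subword $(\rho_a,\rho_b,\rho_c)$ with $a<b<c$ and $\rho_b<\rho_c<\rho_a$. An entry $\rho_i$ is a left-to-right maximum if $\rho_i>\rho_j$ for all $j<i$; the left-to-right maximum preceding position $i$ is $\rho_r$ with $r\le i$ maximal such that $\rho_r$ is a left-to-right maximum. For $\tau=(3,1,2)$ the height vector is $h_i=\#\{k>i:\rho_k<\rho_i\}$, and the path $\psi_{(3,1,2)}(\rho)$, made of up-steps $(1,1)$, down-steps $(1,-1)$ and down-jumps $(0,-1)$, is built as follows: start at $(0,0)$; for $i=1,\dots,n$, if the current endpoint is below height $h_i+1$ append up-steps until height $h_i+1$, otherwise append down-jumps until height $h_i+1$; then append one down-step. The $i$-th down-step corresponds to $\rho_i$. A maximal sequence of $d\ge1$ consecutive down-jumps is a jump of depth $d$; it is at position $i$ if it lies between the $i$-th and $(i+1)$-th down-step. Consecutive down-steps means down-steps with no up-step or down-jump between them. -}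

module Defs where

open import Data.Nat using (ℕ; zero; suc; _+_; _*_; _∸_; _≤_; _<_; _<ᵇ_)
open import Data.Nat.Properties using (_<?_)
open import Data.Fin using (Fin; toℕ; fromℕ<)
open import Data.Fin.Permutation using (Permutation′; _⟨$⟩ʳ_)
open import Data.List using (List; []; _∷_; _++_; map; replicate; upTo; allFin; filterᵇ; concatMap; length)
open import Data.Bool using (Bool; _∧_; if_then_else_)
open import Data.Product using (_×_; _,_)
open import Relation.Nullary using (¬_; yes; no)

-- Value of the permutation at a 0-based index, as an element of {1,…,n}.
val : ∀ {n} → Permutation′ n → Fin n → ℕ
val ρ a = suc (toℕ (ρ ⟨$⟩ʳ a))

-- ρ_t for a 1-based position t ∈ {1,…,n}; returns 0 outside this range
-- (never used outside the range under the theorem's hypotheses).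
entry : ∀ {n} → Permutation′ n → ℕ → ℕ
entry {n} ρ zero = 0
entry {n} ρ (suc t) with t <? n
... | yes t<n = val ρ (fromℕ< t<n)
... | no  _   = 0

height : ∀ {n} → Permutation′ n → Fin n → ℕ
height {n} ρ a = length (filterᵇ (λ b → (toℕ a <ᵇ toℕ b) ∧ (val ρ b <ᵇ val ρ a)) (allFin n))

-- Steps of the path: up-step (1,1), down-step (1,-1), down-jump (0,-1).
data Step : Set where
  U D J : Step

pathFrom : ℕ → List ℕ → List Step
pathFrom cur [] = []
pathFrom cur (h ∷ hs) =
  replicate (suc h ∸ cur) U ++ replicate (cur ∸ suc h) J ++ (D ∷ pathFrom h hs)

ψ : ∀ {n} → Permutation′ n → List Step
ψ {n} ρ = pathFrom 0 (map (height ρ) (allFin n))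

countD : List Step → ℕ
countD [] = 0
countD (D ∷ s) = suc (countD s)
countD (U ∷ s) = countD s
countD (J ∷ s) = countD s

IsLTRMax : ∀ {n} → Permutation′ n → ℕ → Set
IsLTRMax {n} ρ p = 1 ≤ p × p ≤ n × (∀ q → 1 ≤ q → q < p → entry ρ q < entry ρ p)

Occ312 : ∀ {n} → Permutation′ n → ℕ × ℕ × ℕ → Set
Occ312 {n} ρ (a , b , c) =
  1 ≤ a × a < b × b < c × c ≤ n × entry ρ b < entry ρ c × entry ρ c < entry ρ a

betweenPositions : ∀ {n} → Permutation′ n → ℕ → List ℕ
betweenPositions {n} ρ i =
  filterᵇ (λ k → (i <ᵇ k) ∧ (entry ρ (suc i) <ᵇ entry ρ k) ∧ (entry ρ k <ᵇ entry ρ i))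
          (map suc (upTo n))

oneTo : ℕ → List ℕ
oneTo m = map suc (upTo m)

jumpTriples : ∀ {n} → Permutation′ n → (i m l : ℕ) → List (ℕ × ℕ × ℕ)
jumpTriples ρ i m l =
  concatMap (λ g → concatMap (λ j → map (λ k → (suc i ∸ g , i + j , k))
                                         (betweenPositions ρ i))
                             (oneTo l))
            (oneTo m)

{-# OPTIONS --safe #-}
module Submission where

-- The t-th down-step of ψ(ρ) goes from height h_t + 1 to h_t, so two consecutive down-steps at
-- positions t, t + 1 mean h_t = h_{t+1} + 1, and a jump of depth d between them means
-- h_t = h_{t+1} + 1 + d. If ρ_t ≤ ρ_{t+1}, every k counted by h_t is also counted by h_{t+1};
-- hence a drop of height forces ρ_{t+1} < ρ_t, and ρ decreases along both runs of down-steps.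
-- When ρ_{t+1} < ρ_t, the entries after position t that are smaller than ρ_t are ρ_{t+1}, the
-- entries after t + 1 that are smaller than ρ_{t+1}, and the entries strictly between ρ_{t+1}
-- and ρ_t; so at the jump exactly d entries lie strictly between ρ_{i+1} and ρ_i. For g, j and
-- k as in the statement, ρ_{i+j} ≤ ρ_{i+1} < ρ_k < ρ_i ≤ ρ_{i-g+1}, and k lies after the
-- second run because ρ_k > ρ_{i+1}. The triples are the points of an m × l × d product.

open import Defs
open import Data.Bool using (Bool; T; T?; _∧_)
open import Data.Bool.Properties using (T-∧; ∧-zeroʳ)
open import Data.Fin using (toℕ; fromℕ<)
open import Data.Fin.Properties using (toℕ<n; toℕ-fromℕ<; fromℕ<-toℕ; toℕ-injective)
open import Data.Fin.Permutation using (Permutation′)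
open import Data.List
  using (List; []; _∷_; _++_; map; replicate; length; filter; filterᵇ; applyUpTo; upTo;
         tabulate; allFin; concatMap; cartesianProduct)
open import Data.List.Properties
  using (∷-injectiveʳ; ++-assoc; length-++; length-map; length-replicate; length-applyUpTo;
         map-++; map-∘; map-cong; map-upTo; map-tabulate; filter-accept; filter-reject;
         filter-none; filter-≐)
open import Data.List.Membership.Propositional using (_∈_)
open import Data.List.Membership.Propositional.Properties
  using (∈-filter⁻; ∈-map⁻; ∈-map⁺; ∈-upTo⁻; ∈-upTo⁺; ∈-applyUpTo⁻;
         ∈-cartesianProduct⁻)
open import Data.List.Relation.Unary.All as All using (All)
open import Data.List.Relation.Unary.Any using (here; there)
open import Data.List.Relation.Unary.Unique.Propositional using (Unique; _∷_)
import Data.List.Relation.Unary.Unique.Propositional.Properties as Unique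
open import Data.Nat
open import Data.Nat.Properties
open import Data.Product using (_×_; _,_; proj₁; proj₂; ∃; ∃₂; map₁)
open import Data.Product.Function.NonDependent.Propositional using (_×-⇔_)
open import Data.Sum using (_⊎_; inj₁; inj₂; [_,_])
open import Function using (_∘_; id; _⇔_; mk⇔; Equivalence; Injection)
open import Function.Properties.Equivalence using () renaming (trans to ⇔-trans)
open import Function.Properties.Inverse using (↔⇒↣)
open import Level using (0ℓ)
open import Relation.Binary using (DecidableEquality; tri<; tri≈; tri>)
open import Relation.Binary.PropositionalEquality hiding (J; [_])
open import Relation.Nullary using (¬_; yes; no; contradiction)
open import Relation.Unary using (Pred; Decidable; _⊆_)
open import Relation.Unary.Properties using (_∪?_)

open Equivalence using (to; from)

length-filter-mono : ∀ {A : Set} {P Q : Pred A 0ℓ} (P? : Decidable P) (Q? : Decidable Q) →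
                     P ⊆ Q → ∀ xs → length (filter P? xs) ≤ length (filter Q? xs)
length-filter-mono P? Q? P⊆Q [] = z≤n
length-filter-mono P? Q? P⊆Q (x ∷ xs) with P? x | Q? x
... | yes _  | yes _  = s≤s (length-filter-mono P? Q? P⊆Q xs)
... | yes px | no ¬qx = contradiction (P⊆Q px) ¬qx
... | no _   | yes _  = m≤n⇒m≤1+n (length-filter-mono P? Q? P⊆Q xs)
... | no _   | no _   = length-filter-mono P? Q? P⊆Q xs

length-filter-⊎ : ∀ {A : Set} {P Q R : Pred A 0ℓ}
                  (P? : Decidable P) (Q? : Decidable Q) (R? : Decidable R) xs →
                  (∀ {x} → x ∈ xs → P x → Q x ⊎ R x) → (∀ {x} → Q x ⊎ R x → P x) →
                  (∀ {x} → Q x → ¬ R x) →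
                  length (filter P? xs) ≡ length (filter Q? xs) + length (filter R? xs)
length-filter-⊎ P? Q? R? [] _ _ _ = refl
length-filter-⊎ P? Q? R? (x ∷ xs) split join disjoint
  with rest ← length-filter-⊎ P? Q? R? xs (λ x∈ → split (there x∈)) join disjoint | Q? x | R? x
... | yes qx | yes rx = contradiction rx (disjoint qx)
... | yes qx | no _   = trans (cong length (filter-accept P? (join (inj₁ qx)))) (cong suc rest)
... | no _   | yes rx =
  trans (cong length (filter-accept P? (join (inj₂ rx)))) (trans (cong suc rest) (sym (+-suc _ _)))
... | no ¬qx | no ¬rx =
  trans (cong length (filter-reject P? ([ ¬qx , ¬rx ] ∘ split (here refl)))) rest

length-filter-≟ : ∀ {A : Set} (_≟_ : DecidableEquality A) {xs u} →
                  Unique xs → u ∈ xs → length (filter (_≟ u) xs) ≡ 1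
length-filter-≟ _≟_ {x ∷ _} (x∉xs ∷ _) (here refl) =
  trans (cong length (filter-accept (_≟ x) refl))
        (cong (suc ∘ length) (filter-none (_≟ x) (All.map (λ x≢y y≡x → x≢y (sym y≡x)) x∉xs)))
length-filter-≟ _≟_ {_ ∷ _} {u} (x∉xs ∷ xs-unique) (there u∈xs) =
  trans (cong length (filter-reject (_≟ u) (All.lookup x∉xs u∈xs)))
        (length-filter-≟ _≟_ xs-unique u∈xs)

filter-map : ∀ {A B : Set} {P : Pred B 0ℓ} (P? : Decidable P) (f : A → B) xs →
             filter P? (map f xs) ≡ map f (filter (P? ∘ f) xs)
filter-map P? f [] = refl
filter-map P? f (x ∷ xs) with P? (f x)
... | yes _ = cong (f x ∷_) (filter-map P? f xs)
... | no _  = filter-map P? f xs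

filterᵇ-cong : ∀ {A : Set} {p q : A → Bool} → (∀ x → p x ≡ q x) →
               ∀ xs → filterᵇ p xs ≡ filterᵇ q xs
filterᵇ-cong p≗q =
  filter-≐ _ _ ((λ {x} → subst T (p≗q x)) , (λ {x} → subst T (sym (p≗q x))))

range : ℕ → ℕ → List ℕ
range s zero    = []
range s (suc r) = s ∷ range (suc s) r

applyUpTo-range : ∀ (f : ℕ → ℕ) s r → (∀ x → f x ≡ s + x) → applyUpTo f r ≡ range s r
applyUpTo-range f s zero    _      = refl
applyUpTo-range f s (suc r) f≗s+_ =
  cong₂ _∷_ (trans (f≗s+ 0) (+-identityʳ s))
            (applyUpTo-range (f ∘ suc) (suc s) r (λ x → trans (f≗s+ suc x) (+-suc s x)))

tabulate-toℕ : ∀ {A : Set} (g : ℕ → A) r → tabulate {n = r} (g ∘ toℕ) ≡ applyUpTo g r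
tabulate-toℕ g zero    = refl
tabulate-toℕ g (suc r) = cong (g 0 ∷_) (tabulate-toℕ (g ∘ suc) r)

map-oneTo : ∀ {A : Set} (f : ℕ → A) m → map f (oneTo m) ≡ applyUpTo (f ∘ suc) m
map-oneTo f m = trans (sym (map-∘ (upTo m))) (map-upTo (f ∘ suc) m)

oneTo-range : ∀ n → oneTo n ≡ range 1 n
oneTo-range n = trans (map-upTo suc n) (applyUpTo-range suc 1 n (λ _ → refl))

oneTo-allFin : ∀ n → oneTo n ≡ map (suc ∘ toℕ) (allFin n)
oneTo-allFin n = begin
  oneTo n                     ≡⟨ map-upTo suc n ⟩
  applyUpTo suc n             ≡⟨ tabulate-toℕ suc n ⟨
  tabulate (suc ∘ toℕ)        ≡⟨ map-tabulate id (suc ∘ toℕ) ⟨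
  map (suc ∘ toℕ) (allFin n)  ∎
  where open ≡-Reasoning

∈-oneTo⁻ : ∀ {n k} → k ∈ oneTo n → ∃ λ k′ → k′ < n × k ≡ suc k′
∈-oneTo⁻ k∈ with k′ , k′∈ , refl ← ∈-map⁻ suc k∈ = k′ , ∈-upTo⁻ k′∈ , refl

oneTo-unique : ∀ n → Unique (oneTo n)
oneTo-unique n = Unique.map⁺ suc-injective (Unique.upTo⁺ n)

length-cartesianProduct : ∀ {A B : Set} (xs : List A) (ys : List B) →
                          length (cartesianProduct xs ys) ≡ length xs * length ys
length-cartesianProduct []       ys = refl
length-cartesianProduct (x ∷ xs) ys =
  trans (length-++ (map (x ,_) ys))
        (cong₂ _+_ (length-map (x ,_) ys) (length-cartesianProduct xs ys))

concatMap-cartesianProduct : ∀ {A B C X Y : Set} (f : A → X) (g : B → Y) xs ys (zs : List C) →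
  concatMap (λ x → concatMap (λ y → map (λ z → (f x , g y , z)) zs) ys) xs
    ≡ cartesianProduct (map f xs) (cartesianProduct (map g ys) zs)
concatMap-cartesianProduct f g []       ys zs = refl
concatMap-cartesianProduct f g (x ∷ xs) ys zs =
  cong₂ _++_ (row ys) (concatMap-cartesianProduct f g xs ys zs)
  where
  row : ∀ ys → concatMap (λ y → map (λ z → (f x , g y , z)) zs) ys
               ≡ map (f x ,_) (cartesianProduct (map g ys) zs)
  row []       = refl
  row (y ∷ ys) = begin
    map (λ z → (f x , g y , z)) zs ++ concatMap (λ y → map (λ z → (f x , g y , z)) zs) ys
      ≡⟨ cong₂ _++_ (map-∘ zs) (row ys) ⟩
    map (f x ,_) (map (g y ,_) zs) ++ map (f x ,_) (cartesianProduct (map g ys) zs)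
      ≡⟨ map-++ (f x ,_) (map (g y ,_) zs) _ ⟨
    map (f x ,_) (cartesianProduct (map g (y ∷ ys)) zs)
      ∎
    where open ≡-Reasoning

moves : ℕ → ℕ → List Step
moves c h = replicate (suc h ∸ c) U ++ replicate (c ∸ suc h) J

pathFrom-∷ : ∀ c h hs → pathFrom c (h ∷ hs) ≡ moves c h ++ D ∷ pathFrom h hs
pathFrom-∷ c h hs =
  sym (++-assoc (replicate (suc h ∸ c) U) (replicate (c ∸ suc h) J) (D ∷ pathFrom h hs))

countD-++ : ∀ xs ys → countD (xs ++ ys) ≡ countD xs + countD ys
countD-++ []       ys = refl
countD-++ (U ∷ xs) ys = countD-++ xs ys
countD-++ (J ∷ xs) ys = countD-++ xs ys
countD-++ (D ∷ xs) ys = cong suc (countD-++ xs ys)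

countD-UJ : ∀ a b → countD (replicate a U ++ replicate b J) ≡ 0
countD-UJ (suc a) b       = countD-UJ a b
countD-UJ zero    zero    = refl
countD-UJ zero    (suc b) = countD-UJ zero b

countD-moves : ∀ c h → countD (moves c h) ≡ 0
countD-moves c h = countD-UJ (suc h ∸ c) (c ∸ suc h)

UJ≡J : ∀ a b b′ → replicate a U ++ replicate b J ≡ replicate b′ J → a ≡ 0 × b ≡ b′
UJ≡J zero    b b′       eq =
  refl , trans (sym (length-replicate b)) (trans (cong length eq) (length-replicate b′))
UJ≡J (suc a) b zero     ()
UJ≡J (suc a) b (suc b′) ()

moves≡J : ∀ c h b → moves c h ≡ replicate b J → c ≡ b + suc h
moves≡J c h b eq with no-up , jumps ← UJ≡J (suc h ∸ c) (c ∸ suc h) b eq =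
  trans (sym (m∸n+n≡m (m∸n≡0⇒m≤n no-up))) (cong (_+ suc h) jumps)

++-D-cancel : ∀ u u′ {v v′} → countD u ≡ 0 → countD u′ ≡ 0 →
              u ++ D ∷ v ≡ u′ ++ D ∷ v′ → u ≡ u′ × v ≡ v′
++-D-cancel (D ∷ _) _       ()  _  _
++-D-cancel _       (D ∷ _) _   () _
++-D-cancel []      []      _   _  eq = refl , ∷-injectiveʳ eq
++-D-cancel []      (U ∷ _) _   _  ()
++-D-cancel []      (J ∷ _) _   _  ()
++-D-cancel (U ∷ _) []      _   _  ()
++-D-cancel (J ∷ _) []      _   _  ()
++-D-cancel (U ∷ _) (J ∷ _) _   _  ()
++-D-cancel (J ∷ _) (U ∷ _) _   _  ()
++-D-cancel (U ∷ u) (U ∷ u′) c c′ eq =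
  map₁ (cong (U ∷_)) (++-D-cancel u u′ c c′ (∷-injectiveʳ eq))
++-D-cancel (J ∷ u) (J ∷ u′) c c′ eq =
  map₁ (cong (J ∷_)) (++-D-cancel u u′ c c′ (∷-injectiveʳ eq))

first-D : ∀ xs {p} → countD xs ≡ suc p →
          ∃₂ λ u w → countD u ≡ 0 × countD w ≡ p × xs ≡ u ++ D ∷ w
first-D (D ∷ w)  eq = [] , w , refl , suc-injective eq , refl
first-D (U ∷ xs) eq with u , w , cu , cw , refl ← first-D xs eq = U ∷ u , w , cu , cw , refl
first-D (J ∷ xs) eq with u , w , cu , cw , refl ← first-D xs eq = J ∷ u , w , cu , cw , refl

-- Z is the part of the path of the heights f 1, …, f n that follows its s-th down-step.
After : (ℕ → ℕ) → ℕ → ℕ → List Step → Set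
After f n s Z = ∃ λ r → s + r ≡ n × Z ≡ pathFrom (f s) (map f (range (suc s) r))

after-≤ : ∀ {f n s Z} → After f n s Z → s ≤ n
after-≤ {s = s} (r , s+r≡n , _) = subst (s ≤_) s+r≡n (m≤m+n s r)

after-moves : ∀ {f n s u Z} → countD u ≡ 0 → After f n s (u ++ D ∷ Z) →
              moves (f s) (f (suc s)) ≡ u × After f n (suc s) Z
after-moves {u = []}    _ (zero , _ , ())
after-moves {u = _ ∷ _} _ (zero , _ , ())
after-moves {f} {s = s} {u} u-free (suc r , s+r≡n , eq)
  with moves≡u , Z≡ ← ++-D-cancel (moves (f s) (f (suc s))) u
                                   (countD-moves (f s) (f (suc s))) u-free
                         (trans (sym (pathFrom-∷ (f s) (f (suc s)) (map f (range (suc (suc s)) r))))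
                                (sym eq))
  = moves≡u , r , trans (sym (+-suc s r)) s+r≡n , sym Z≡

after-step : ∀ {f n s} b {Z} → After f n s (replicate b J ++ D ∷ Z) →
             f s ≡ b + suc (f (suc s)) × After f n (suc s) Z
after-step {f} {s = s} b A with moves≡Jb , A′ ← after-moves (countD-UJ 0 b) A =
  moves≡J (f s) (f (suc s)) b moves≡Jb , A′

after-prefix : ∀ {f n s} pre {p Z} → countD pre ≡ p → After f n s (pre ++ D ∷ Z) →
               After f n (suc (s + p)) Z
after-prefix {f} {n} {s} pre {zero} {Z} pre-free A =
  subst (λ t → After f n (suc t) Z) (sym (+-identityʳ s)) (proj₂ (after-moves pre-free A))
after-prefix {f} {n} {s} pre {suc p} {Z} count A
  with u , w , u-free , count-w , refl ← first-D pre count =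
  subst (λ t → After f n (suc t) Z) (sym (+-suc s p))
        (after-prefix w count-w
          (proj₂ (after-moves u-free (subst (After f n s) (++-assoc u (D ∷ w) (D ∷ Z)) A))))

Descending : (ℕ → ℕ) → ℕ → ℕ → Set
Descending g s u = ∀ {t} → s ≤ t → t < u → g (suc t) < g t

after-Ds : ∀ {f n s} a {Z} → After f n s (replicate a D ++ Z) →
           Descending f s (a + s) × After f n (a + s) Z
after-Ds zero A = (λ s≤t t<s → contradiction s≤t (<⇒≱ t<s)) , A
after-Ds {f} {n} {s} (suc a) {Z} A
  with step , A′ ← after-step 0 A
  with descending , A″ ← after-Ds a A′ =
  extend , subst (λ t → After f n t Z) (+-suc a s) A″
  where
  extend : Descending f s (suc a + s)
  extend {t} s≤t t<a+s with m≤n⇒m<n∨m≡n s≤t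
  ... | inj₂ refl = subst (f (suc s) <_) (sym step) (n<1+n _)
  ... | inj₁ s<t  = descending s<t (subst (t <_) (sym (+-suc a s)) t<a+s)

JumpBlock : (ℕ → ℕ) → (n d l s q : ℕ) → Set
JumpBlock f n d l s q =
  Descending f s q × f q ≡ d + suc (f (suc q)) × Descending f (suc q) (l + suc q) × suc q ≤ n

jumpBlock : ∀ {f n} pre {p} m d l {post} → countD pre ≡ p →
  After f n 0 (pre ++ U ∷ replicate (suc m) D ++ replicate d J ++ replicate (suc l) D ++ post) →
  JumpBlock f n d l (suc p) (m + suc p)
jumpBlock {f} {n} pre m d l {post} count A =
  let run₁ , A₁ = after-Ds m (after-prefix (pre ++ U ∷ []) count′ A′)
      jump , A₂ = after-step d A₁
      run₂ , _  = after-Ds l A₂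
  in  run₁ , jump , run₂ , after-≤ A₂
  where
  A′ = subst (After f n 0) (sym (++-assoc pre (U ∷ []) _)) A
  count′ = trans (countD-++ pre (U ∷ [])) (trans (+-identityʳ _) count)

AntitoneOn : (ℕ → ℕ) → ℕ → ℕ → Set
AntitoneOn g s u = ∀ {x y} → s ≤ x → x ≤ y → y ≤ u → g y ≤ g x

descending⇒antitoneOn : ∀ {g s u} → Descending g s u → AntitoneOn g s u
descending⇒antitoneOn desc {y = zero}  _   z≤n _ = ≤-refl
descending⇒antitoneOn desc {y = suc y} s≤x x≤y y<u with m≤n⇒m<n∨m≡n x≤y
... | inj₂ refl       = ≤-refl
... | inj₁ (s≤s x≤y′) =
  <⇒≤ (<-≤-trans (desc (≤-trans s≤x x≤y′) y<u)
                 (descending⇒antitoneOn desc s≤x x≤y′ (≤-trans (n≤1+n y) y<u)))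

T-<ᵇ : ∀ {m n} → T (m <ᵇ n) ⇔ m < n
T-<ᵇ = mk⇔ (<ᵇ⇒< _ _) <⇒<ᵇ

module _ {n} (ρ : Permutation′ n) where

  entry-suc : ∀ {t} (t<n : t < n) → entry ρ (suc t) ≡ val ρ (fromℕ< t<n)
  entry-suc {t} t<n with t <? n
  ... | yes _   = refl
  ... | no  t≮n = contradiction t<n t≮n

  entry-toℕ : ∀ a → entry ρ (suc (toℕ a)) ≡ val ρ a
  entry-toℕ a = trans (entry-suc (toℕ<n a)) (cong (val ρ) (fromℕ<-toℕ a (toℕ<n a)))

  entry-injective : ∀ {x y} → x < n → y < n → entry ρ (suc x) ≡ entry ρ (suc y) → x ≡ y
  entry-injective {x} {y} x<n y<n eq = begin
    x                 ≡⟨ toℕ-fromℕ< x<n ⟨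
    toℕ (fromℕ< x<n)  ≡⟨ cong toℕ (Injection.injective (↔⇒↣ ρ) (toℕ-injective val≡)) ⟩
    toℕ (fromℕ< y<n)  ≡⟨ toℕ-fromℕ< y<n ⟩
    y                 ∎
    where
    open ≡-Reasoning
    val≡ = suc-injective (trans (sym (entry-suc x<n)) (trans eq (entry-suc y<n)))

  below : ℕ → ℕ → Bool
  below t k = (t <ᵇ k) ∧ (entry ρ k <ᵇ entry ρ t)

  between : ℕ → ℕ → Bool
  between t k = (t <ᵇ k) ∧ (entry ρ (suc t) <ᵇ entry ρ k) ∧ (entry ρ k <ᵇ entry ρ t)

  T-below : ∀ t k → T (below t k) ⇔ (t < k × entry ρ k < entry ρ t)
  T-below _ _ = ⇔-trans T-∧ (T-<ᵇ ×-⇔ T-<ᵇ)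

  T-between : ∀ t k → T (between t k) ⇔
              (t < k × entry ρ (suc t) < entry ρ k × entry ρ k < entry ρ t)
  T-between _ _ = ⇔-trans T-∧ (T-<ᵇ ×-⇔ ⇔-trans T-∧ (T-<ᵇ ×-⇔ T-<ᵇ))

  heightAt : ℕ → ℕ
  heightAt t = length (filterᵇ (below t) (oneTo n))

  -- Since entry ρ 0 = 0, the whole path ψ ρ is the part after a virtual down-step at position 0.
  heightAt-zero : heightAt 0 ≡ 0
  heightAt-zero =
    cong length (filter-none (T? ∘ below 0)
                             (All.universal (λ k → subst T (∧-zeroʳ (0 <ᵇ k))) (oneTo n)))

  height≡heightAt : ∀ a → height ρ a ≡ heightAt (suc (toℕ a))
  height≡heightAt a = sym (begin
    length (filterᵇ (below (suc (toℕ a))) (oneTo n))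
      ≡⟨ cong (length ∘ filterᵇ (below (suc (toℕ a)))) (oneTo-allFin n) ⟩
    length (filterᵇ (below (suc (toℕ a))) (map (suc ∘ toℕ) (allFin n)))
      ≡⟨ cong length (filter-map _ (suc ∘ toℕ) (allFin n)) ⟩
    length (map (suc ∘ toℕ) (filterᵇ (below (suc (toℕ a)) ∘ suc ∘ toℕ) (allFin n)))
      ≡⟨ length-map (suc ∘ toℕ) (filterᵇ (below (suc (toℕ a)) ∘ suc ∘ toℕ) (allFin n)) ⟩
    length (filterᵇ (below (suc (toℕ a)) ∘ suc ∘ toℕ) (allFin n))
      ≡⟨ cong length (filterᵇ-cong same-test (allFin n)) ⟩
    height ρ a
      ∎)
    where
    open ≡-Reasoning
    same-test : ∀ b → below (suc (toℕ a)) (suc (toℕ b))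
                      ≡ (toℕ a <ᵇ toℕ b) ∧ (val ρ b <ᵇ val ρ a)
    same-test b = cong₂ (λ x y → (toℕ a <ᵇ toℕ b) ∧ (x <ᵇ y)) (entry-toℕ b) (entry-toℕ a)

  ψ-after : After heightAt n 0 (ψ ρ)
  ψ-after = n , refl , cong₂ pathFrom (sym heightAt-zero) (begin
    map (height ρ) (allFin n)                  ≡⟨ map-cong height≡heightAt (allFin n) ⟩
    map (heightAt ∘ suc ∘ toℕ) (allFin n)      ≡⟨ map-∘ (allFin n) ⟩
    map heightAt (map (suc ∘ toℕ) (allFin n))  ≡⟨ cong (map heightAt) (oneTo-allFin n) ⟨
    map heightAt (oneTo n)                     ≡⟨ cong (map heightAt) (oneTo-range n) ⟩
    map heightAt (range 1 n)                   ∎)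
    where open ≡-Reasoning

  heightAt-mono : ∀ {t} → entry ρ t ≤ entry ρ (suc t) → heightAt t ≤ heightAt (suc t)
  heightAt-mono {t} rise =
    length-filter-mono (T? ∘ below t) (T? ∘ below (suc t)) (λ {k} → shift {k}) (oneTo n)
    where
    shift : ∀ {k} → T (below t k) → T (below (suc t) k)
    shift {k} b with t<k , k<t ← to (T-below t k) b =
      from (T-below (suc t) k) (≤∧≢⇒< t<k (λ { refl → <⇒≱ k<t rise }) , <-≤-trans k<t rise)

  heightAt-descent : ∀ {t} → heightAt (suc t) < heightAt t → entry ρ (suc t) < entry ρ t
  heightAt-descent fall = ≰⇒> (λ rise → <⇒≱ fall (heightAt-mono rise))

  heightAt-descending⇒antitoneOn : ∀ {s u} → Descending heightAt s u → AntitoneOn (entry ρ) s u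
  heightAt-descending⇒antitoneOn desc =
    descending⇒antitoneOn (λ s≤t t<u → heightAt-descent (desc s≤t t<u))

  -- The k counted by heightAt t are t + 1, those counted by heightAt (t + 1), and those
  -- in betweenPositions ρ t; injectivity of ρ rules out entry ρ k = entry ρ (t + 1).
  heightAt-jump : ∀ {t} → t < n → entry ρ (suc t) < entry ρ t →
                  heightAt t ≡ suc (heightAt (suc t) + length (betweenPositions ρ t))
  heightAt-jump {t} t<n fall =
    trans (length-filter-⊎ (T? ∘ below t) (_≟ suc t) rest? (oneTo n) split join disjoint)
          (cong₂ _+_ (length-filter-≟ _≟_ (oneTo-unique n) (∈-map⁺ suc (∈-upTo⁺ t<n)))
                     (length-filter-⊎ rest? (T? ∘ below (suc t)) (T? ∘ between t) (oneTo n)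
                                      (λ _ → id) id (λ {k} → disjoint′ {k})))
    where
    rest? = (T? ∘ below (suc t)) ∪? (T? ∘ between t)

    split : ∀ {k} → k ∈ oneTo n → T (below t k) →
            k ≡ suc t ⊎ T (below (suc t) k) ⊎ T (between t k)
    split {k} k∈ b with to (T-below t k) b | ∈-oneTo⁻ k∈
    ... | t<k , k<t | k′ , k′<n , refl with m≤n⇒m<n∨m≡n t<k
    ...   | inj₂ refl  = inj₁ refl
    ...   | inj₁ t+1<k with <-cmp (entry ρ (suc k′)) (entry ρ (suc t))
    ...     | tri< k<t+1 _ _ = inj₂ (inj₁ (from (T-below _ _) (t+1<k , k<t+1)))
    ...     | tri≈ _ k≈t+1 _ =
      contradiction (entry-injective k′<n t<n k≈t+1)
                    (λ k′≡t → <-irrefl (sym k′≡t) (s<s⁻¹ t+1<k))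
    ...     | tri> _ _ k>t+1 = inj₂ (inj₂ (from (T-between _ _) (t<k , k>t+1 , k<t)))

    join : ∀ {k} → k ≡ suc t ⊎ T (below (suc t) k) ⊎ T (between t k) → T (below t k)
    join (inj₁ refl) = from (T-below t (suc t)) (n<1+n t , fall)
    join {k} (inj₂ (inj₁ b)) with t+1<k , k<t+1 ← to (T-below (suc t) k) b =
      from (T-below t k) (<-trans (n<1+n t) t+1<k , <-trans k<t+1 fall)
    join {k} (inj₂ (inj₂ b)) with t<k , _ , k<t ← to (T-between t k) b =
      from (T-below t k) (t<k , k<t)

    disjoint : ∀ {k} → k ≡ suc t → ¬ (T (below (suc t) k) ⊎ T (between t k))
    disjoint refl (inj₁ b) = <-irrefl refl (proj₁ (to (T-below (suc t) (suc t)) b))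
    disjoint refl (inj₂ b) = <-irrefl refl (proj₁ (proj₂ (to (T-between t (suc t)) b)))

    disjoint′ : ∀ {k} → T (below (suc t) k) → ¬ T (between t k)
    disjoint′ {k} b b′ =
      <-asym (proj₂ (to (T-below (suc t) k) b)) (proj₁ (proj₂ (to (T-between t k) b′)))

  ∈-betweenPositions⁻ : ∀ {t k} → k ∈ betweenPositions ρ t →
                        k ≤ n × t < k × entry ρ (suc t) < entry ρ k × entry ρ k < entry ρ t
  ∈-betweenPositions⁻ {t} {k} k∈
    with k∈oneTo , b ← ∈-filter⁻ (T? ∘ between t) {xs = oneTo n} k∈
    with _ , k′<n , refl ← ∈-oneTo⁻ {n} k∈oneTo = k′<n , to (T-between t k) b

  jump-shape : ∀ {i m d l pre post} → suc m ≤ i →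
    ψ ρ ≡ pre ++ U ∷ replicate (suc m) D ++ replicate d J ++ replicate (suc l) D ++ post →
    countD pre ≡ i ∸ suc m →
    AntitoneOn (entry ρ) (suc (i ∸ suc m)) i × length (betweenPositions ρ i) ≡ d ×
    AntitoneOn (entry ρ) (suc i) (i + suc l)
  jump-shape {i} {m} {d} {l} {pre} m<i ψ≡ count
    with run₁ , jump , run₂ , i<n ←
           subst (JumpBlock heightAt n d l (suc (i ∸ suc m))) (trans (+-suc m _) (m+[n∸m]≡n m<i))
                 (jumpBlock pre m d l count (subst (After heightAt n 0) ψ≡ ψ-after)) =
    heightAt-descending⇒antitoneOn run₁ ,
    +-cancelˡ-≡ h _ d (suc-injective (begin
      suc (h + length (betweenPositions ρ i))  ≡⟨ heightAt-jump i<n fall ⟨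
      heightAt i                               ≡⟨ jump ⟩
      d + suc h                                ≡⟨ +-suc d h ⟩
      suc (d + h)                              ≡⟨ cong suc (+-comm d h) ⟩
      suc (h + d)                              ∎)) ,
    heightAt-descending⇒antitoneOn
      (subst (Descending heightAt (suc i)) (trans (+-comm l (suc i)) (sym (+-suc i l))) run₂)
    where
    open ≡-Reasoning
    h = heightAt (suc i)
    fall = heightAt-descent (≤-trans (m≤n+m (suc h) d) (≤-reflexive (sym jump)))

  jumpTriples-product : ∀ i m l → jumpTriples ρ i m l ≡
    cartesianProduct (applyUpTo (i ∸_) m)
                     (cartesianProduct (applyUpTo (λ j → i + suc j) l) (betweenPositions ρ i))
  jumpTriples-product i m l =
    trans (concatMap-cartesianProduct (suc i ∸_) (i +_) (oneTo m) (oneTo l) (betweenPositions ρ i))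
          (cong₂ (λ xs ys → cartesianProduct xs (cartesianProduct ys (betweenPositions ρ i)))
                 (map-oneTo (suc i ∸_) m) (map-oneTo (i +_) l))

  length-jumpTriples : ∀ i m l →
                       length (jumpTriples ρ i m l) ≡ m * length (betweenPositions ρ i) * l
  length-jumpTriples i m l = begin
    length (jumpTriples ρ i m l)
      ≡⟨ cong length (jumpTriples-product i m l) ⟩
    length (cartesianProduct firsts (cartesianProduct seconds B))
      ≡⟨ length-cartesianProduct firsts _ ⟩
    length firsts * length (cartesianProduct seconds B)
      ≡⟨ cong₂ _*_ (length-applyUpTo _ m) (length-cartesianProduct seconds B) ⟩
    m * (length seconds * length B)
      ≡⟨ cong (λ x → m * (x * length B)) (length-applyUpTo _ l) ⟩
    m * (l * length B)
      ≡⟨ cong (m *_) (*-comm l (length B)) ⟩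
    m * (length B * l)
      ≡⟨ *-assoc m (length B) l ⟨
    m * length B * l
      ∎
    where
    open ≡-Reasoning
    firsts = applyUpTo (i ∸_) m
    seconds = applyUpTo (λ j → i + suc j) l
    B = betweenPositions ρ i

  unique-jumpTriples : ∀ {i m} l → m ≤ i → Unique (jumpTriples ρ i m l)
  unique-jumpTriples {i} {m} l m≤i = subst Unique (sym (jumpTriples-product i m l))
    (Unique.cartesianProduct⁺
      (Unique.applyUpTo⁺₁ (i ∸_) m
        (λ x<y y<m → >⇒≢ (∸-monoʳ-< x<y (≤-trans (<⇒≤ y<m) m≤i))))
      (Unique.cartesianProduct⁺
        (Unique.applyUpTo⁺₁ (λ j → i + suc j) l (λ x<y _ → <⇒≢ (+-monoʳ-< i (s<s x<y))))
        (Unique.filter⁺ (T? ∘ between i) (oneTo-unique n))))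

  jump-occurrence : ∀ {i m l g j k} → m ≤ i →
    AntitoneOn (entry ρ) (suc (i ∸ m)) i → AntitoneOn (entry ρ) (suc i) (i + l) →
    g < m → j < l → k ∈ betweenPositions ρ i → Occ312 ρ (i ∸ g , i + suc j , k)
  jump-occurrence {i} {m} {l} {g} {j} {k} m≤i run₁ run₂ g<m j<l k∈
    with k≤n , i<k , i+1<k , k<i ← ∈-betweenPositions⁻ k∈ =
    m<n⇒0<n∸m (<-≤-trans g<m m≤i) ,
    ≤-<-trans (m∸n≤m i g) (m<m+n i z<s) ,
    ≤-<-trans (+-monoʳ-≤ i j<l) beyond-run ,
    k≤n ,
    ≤-<-trans (run₂ ≤-refl (m<m+n i z<s) (+-monoʳ-≤ i j<l)) i+1<k ,
    <-≤-trans k<i (run₁ (∸-monoʳ-< g<m m≤i) (m∸n≤m i g) ≤-refl)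
    where
    beyond-run : i + l < k
    beyond-run = ≰⇒> (λ k≤i+l → <⇒≱ i+1<k (run₂ ≤-refl i<k k≤i+l))

  jumpTriples-occurrences : ∀ {i m} l → m ≤ i →
    AntitoneOn (entry ρ) (suc (i ∸ m)) i → AntitoneOn (entry ρ) (suc i) (i + l) →
    All (Occ312 ρ) (jumpTriples ρ i m l)
  jumpTriples-occurrences {i} {m} l m≤i run₁ run₂ =
    subst (All (Occ312 ρ)) (sym (jumpTriples-product i m l)) (All.tabulate occurrence)
    where
    firsts = applyUpTo (i ∸_) m
    seconds = applyUpTo (λ j → i + suc j) l
    occurrence : ∀ {abk} →
                 abk ∈ cartesianProduct firsts (cartesianProduct seconds (betweenPositions ρ i)) →
                 Occ312 ρ abk
    occurrence abk∈
      with a∈ , bk∈ ← ∈-cartesianProduct⁻ firsts _ abk∈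
      with b∈ , k∈ ← ∈-cartesianProduct⁻ seconds (betweenPositions ρ i) bk∈
      with g , g<m , refl ← ∈-applyUpTo⁻ (i ∸_) a∈
      with j , j<l , refl ← ∈-applyUpTo⁻ (λ j → i + suc j) b∈
      = jump-occurrence m≤i run₁ run₂ g<m j<l k∈

mainTheorem3 : (n : ℕ) (ρ : Permutation′ n) (i m d l : ℕ) (pre post : List Step) →
    1 ≤ m → 1 ≤ d → 1 ≤ l → m ≤ i →
    ψ ρ ≡ pre ++ (U ∷ replicate m D ++ replicate d J ++ replicate l D ++ post) →
    countD pre ≡ i ∸ m →
    IsLTRMax ρ (suc i ∸ m) →
    (∀ p → suc i ∸ m < p → p ≤ i → ¬ IsLTRMax ρ p) →
    length (betweenPositions ρ i) ≡ d
      × length (jumpTriples ρ i m l) ≡ m * d * l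
      × Unique (jumpTriples ρ i m l)
      × All (Occ312 ρ) (jumpTriples ρ i m l)
mainTheorem3 n ρ i (suc m) d (suc l) pre post _ _ _ m<i ψ≡ count _ _
  with run₁ , |B|≡d , run₂ ← jump-shape ρ m<i ψ≡ count =
  |B|≡d ,
  trans (length-jumpTriples ρ i (suc m) (suc l)) (cong (λ x → suc m * x * suc l) |B|≡d) ,
  unique-jumpTriples ρ (suc l) m<i ,
  jumpTriples-occurrences ρ (suc l) m<i run₁ run₂
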